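{- Let $S$ be a clustering instance and $T$ be its execution tree with respect to $\mathcal{P}$. Suppose $\mathcal{P}$ is a convex polytope; then for each node $v=(\mathcal{M},\mathcal{Q})\in T$, $\mathcal{Q}$ is a convex polytope.
   Context: A clustering instance is a finite point set $S$, $|S|=n$. Let $\Delta=\{D_1,\dots,D_l\}$ be merge functions $D_i(A,B;d')$, $\delta=\{d_1,\dots,d_m\}$ metrics, $d=lm-1$, pairs indexed by $1,\dots,d+1$, $\alpha^{(\rho)}_k=\rho_k$ ($k\le d$), $\alpha^{(\rho)}_{d+1}=1-\sum_{k\le d}\rho_k$, and $D_\rho(A,B;\delta)=\sum_{i,j}\alpha^{(\rho)}_{i,j}D_i(A,B;d_j)$ (affine in $\rho$). $\mathcal{A}_\rho$ is the linkage algorithm which starts from singleton clusters and repeatedly merges a pair of current clusters minimizing $D_\rho$; a merge sequence is attainable by $\mathcal{A}_\rho$ if each merge is of a pair minimizing $D_\rho$ among the current cluster pairs. Let $\emptyset\neq\mathcal{P}\subseteq[0,1]^d$. The execution tree on $S$ with respect to $\mathcal{P}$ is the rooted tree with root $([],\mathcal{P})$ in which the children of a node $([u_1,\dots,u_t],\mathcal{Q})$ with $t<n-1$ are the nodes $([u_1,\dots,u_t,(A,B)],\mathcal{Q}_{A,B})$ for all cluster pairs $A,B$ such that $(A,B)$ is the $(t+1)$-st merge by $\mathcal{A}_\rho$ for exactly the $\rho\in\mathcal{Q}_{A,B}$, with $\emptyset\neq\mathcal{Q}_{A,B}\subseteq\mathcal{Q}$. -}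

module Defs where

open import Level using (Level; _⊔_)
open import Data.Nat as ℕ using (ℕ; _∸_)
open import Data.Fin as Fin using (Fin; zero; suc; toℕ; fromℕ<; remQuot)
open import Data.Fin.Subset using (Subset; ⁅_⁆; _∪_)
open import Data.Product using (Σ; ∃; _×_; _,_; proj₁; proj₂)
open import Data.List using (List; []; _∷ʳ_; length)
open import Relation.Nullary using (¬_; yes; no)
open import Relation.Binary.PropositionalEquality using (_≡_)
open import Relation.Binary.Structures using (IsTotalOrder)
open import Relation.Unary using (Pred)
open import Function.Bundles using (_⇔_)
open import Algebra.Bundles using (CommutativeRing)

-- Ordered fields (the reals are the intended model)

record OrderedField (c ℓ : Level) : Set (Level.suc (c ⊔ ℓ)) where
  field
    commutativeRing : CommutativeRing c ℓ
  open CommutativeRing commutativeRing public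
  field
    _≤_          : Carrier → Carrier → Set ℓ
    isTotalOrder : IsTotalOrder _≈_ _≤_
    +-monoʳ-≤    : ∀ {x y} z → x ≤ y → (x + z) ≤ (y + z)
    *-nonneg     : ∀ {x y} → 0# ≤ x → 0# ≤ y → 0# ≤ (x * y)
    0≉1          : ¬ (0# ≈ 1#)
    inverse      : ∀ x → ¬ (x ≈ 0#) → Σ Carrier (λ y → (x * y) ≈ 1#)

module Clustering {c ℓ : Level} (F : OrderedField c ℓ) where
  open OrderedField F hiding (zero)

  sumF : ∀ {k} → (Fin k → Carrier) → Carrier
  sumF {ℕ.zero}  f = 0#
  sumF {ℕ.suc k} f = f zero + sumF (λ i → f (suc i))

  Point : ℕ → Set c
  Point d = Fin d → Carrier

  InUnitCube : ∀ {d} → Point d → Set ℓ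
  InUnitCube ρ = ∀ k → (0# ≤ ρ k) × (ρ k ≤ 1#)

  ConvexPolytope : ∀ {d} → Pred (Point d) (c ⊔ ℓ) → Set (c ⊔ ℓ)
  ConvexPolytope {d} Q =
    Σ ℕ λ h → Σ (Fin h → Fin d → Carrier) λ a → Σ (Fin h → Carrier) λ b →
      (∀ ρ → Q ρ ⇔ (∀ i → sumF (λ k → a i k * ρ k) ≤ b i))
      × Σ Carrier (λ M → ∀ ρ → Q ρ → ∀ k → ((- M) ≤ ρ k) × (ρ k ≤ M))

  Metric : ℕ → Set c
  Metric n = Fin n → Fin n → Carrier

  IsMetric : ∀ {n} → Metric n → Set ℓ
  IsMetric {n} δ = (∀ x y → 0# ≤ δ x y) × (∀ x → δ x x ≈ 0#)
                 × (∀ x y → δ x y ≈ 0# → x ≡ y) × (∀ x y → δ x y ≈ δ y x)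
                 × (∀ x y z → δ x z ≤ (δ x y + δ y z))

  Cluster : ℕ → Set
  Cluster n = Subset n

  MergeFunction : ℕ → Set c
  MergeFunction n = Cluster n → Cluster n → Metric n → Carrier

  Merge : ℕ → Set
  Merge n = Cluster n × Cluster n

  data Current {n : ℕ} : List (Merge n) → Cluster n → Set where
    init : ∀ i → Current [] ⁅ i ⁆
    keep : ∀ {M A B C} → Current M C → ¬ (C ≡ A) → ¬ (C ≡ B) → Current (M ∷ʳ (A , B)) C
    new  : ∀ {M A B} → Current M A → Current M B → ¬ (A ≡ B) → Current (M ∷ʳ (A , B)) (A ∪ B)

  module Family {n l m : ℕ} (Δ : Fin l → MergeFunction n) (δ : Fin m → Metric n) where

    dim : ℕ
    dim = (l ℕ.* m) ∸ 1

    α : Point dim → Fin (l ℕ.* m) → Carrier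
    α ρ k with toℕ k ℕ.<? dim
    ... | yes p = ρ (fromℕ< p)
    ... | no _  = 1# - sumF ρ

    pairOf : Fin (l ℕ.* m) → Fin l × Fin m
    pairOf = remQuot {l} m

    Dρ : Point dim → Cluster n → Cluster n → Carrier
    Dρ ρ A B = sumF (λ k → α ρ k * Δ (proj₁ (pairOf k)) A B (δ (proj₂ (pairOf k))))

    Minimizes : Point dim → List (Merge n) → Cluster n → Cluster n → Set ℓ
    Minimizes ρ M A B = ∀ A′ B′ → Current M A′ → Current M B′ → ¬ (A′ ≡ B′) → Dρ ρ A B ≤ Dρ ρ A′ B′

    data Node (P : Pred (Point dim) (c ⊔ ℓ)) : List (Merge n) → Pred (Point dim) (c ⊔ ℓ) → Set (Level.suc (c ⊔ ℓ)) where
      root  : Node P [] P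
      child : ∀ {M Q A B} → Node P M Q → length M ℕ.< n ∸ 1
            → Current M A → Current M B → ¬ (A ≡ B)
            → Σ (Point dim) (λ ρ → Q ρ × Minimizes ρ M A B)
            → Node P (M ∷ʳ (A , B)) (λ ρ → Q ρ × Minimizes ρ M A B)

{-# OPTIONS --safe #-}
-- D_ρ(A, B) is an affine function of ρ, so each comparison D_ρ(A, B) ≤ D_ρ(A′, B′)
-- carves out a closed half-space.  The parameters for which (A, B) is the next merge
-- are those satisfying one such comparison for every pair (A′, B′) of distinct current
-- clusters; there are finitely many pairs and being current is decidable, so this set
-- is cut out by finitely many linear inequalities.  A child node therefore intersects
-- the polytope of its parent with a polyhedron, which is again a polytope.
module Submission where

open import Defs
open import Level using (_⊔_)
open import Data.Nat as ℕ using (ℕ; NonZero; zero; suc; _<?_)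
open import Data.Fin using (Fin; zero; suc; toℕ; fromℕ<; splitAt; _↑ˡ_; _↑ʳ_)
open import Data.Fin.Properties using (splitAt-↑ˡ; splitAt-↑ʳ; any?)
open import Data.Fin.Subset using (Subset; ⁅_⁆; _∪_; inside; outside)
import Data.Bool as Bool
open import Data.Vec using ([]; _∷_)
open import Data.Vec.Properties using (≡-dec)
open import Data.List using (List; []; _∷_; _∷ʳ_)
open import Data.List.Properties using (∷ʳ-injective)
open import Data.List.Reverse using (Reverse; reverseView; []; _∶_∶ʳ_)
open import Data.Product using (Σ; ∃; _×_; _,_; proj₁; proj₂)
open import Data.Sum using (_⊎_; inj₁; inj₂; [_,_]′)
open import Data.Empty using (⊥; ⊥-elim)
open import Function using (_∘_)
open import Function.Bundles using (_⇔_; mk⇔; Equivalence)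
import Function.Properties.Equivalence as ⇔
open import Relation.Nullary using (¬_; Dec; yes; no)
open import Relation.Nullary.Decidable as Dec using (_×-dec_; _⊎-dec_; ¬?)
open import Relation.Binary.PropositionalEquality as ≡ using (_≡_; cong; cong₂; subst)
open import Relation.Binary.Structures using (IsTotalOrder)
open import Relation.Unary using (Pred; _∩_)

module _ {c ℓ} (F : OrderedField c ℓ) where
  open OrderedField F hiding (zero)
  open Clustering F
  open import Algebra.Properties.Semiring.Sum semiring
    using (sum; sum-cong-≋; ∑-distrib-+; *-distribʳ-sum; sum-replicate-zero)
  open import Algebra.Properties.Ring ring using (-1*x≈-x)
  open import Algebra.Properties.Group +-group using (//-rightDividesʳ)
  open import Algebra.Properties.CommutativeSemigroup +-commutativeSemigroup
    using (interchange)
  open import Algebra.Properties.CommutativeSemigroup *-commutativeSemigroup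
    using (xy∙z≈xz∙y)
  open import Relation.Binary.Reasoning.Setoid setoid
  open IsTotalOrder isTotalOrder using (≲-resp-≈)

  ≤-cong : ∀ {x x′ y y′} → x ≈ x′ → y ≈ y′ → x ≤ y ⇔ x′ ≤ y′
  ≤-cong x≈x′ y≈y′ = mk⇔ (resp x≈x′ y≈y′) (resp (sym x≈x′) (sym y≈y′))
    where
    resp : ∀ {x x′ y y′} → x ≈ x′ → y ≈ y′ → x ≤ y → x′ ≤ y′
    resp x≈x′ y≈y′ = proj₁ ≲-resp-≈ y≈y′ ∘ proj₂ ≲-resp-≈ x≈x′

  +-monoʳ-≤-⇔ : ∀ {x y} z → x ≤ y ⇔ (x + z) ≤ (y + z)
  +-monoʳ-≤-⇔ {x} {y} z = mk⇔ (+-monoʳ-≤ z) cancel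
    where
    cancel : (x + z) ≤ (y + z) → x ≤ y
    cancel = Equivalence.to (≤-cong (//-rightDividesʳ z x) (//-rightDividesʳ z y)) ∘ +-monoʳ-≤ (- z)

  ≤⇔-≤0 : ∀ x y → x ≤ y ⇔ (x - y) ≤ 0#
  ≤⇔-≤0 x y = ⇔.trans (+-monoʳ-≤-⇔ (- y)) (≤-cong refl (-‿inverseʳ y))

  +≤0⇔≤- : ∀ x y → (x + y) ≤ 0# ⇔ x ≤ (- y)
  +≤0⇔≤- x y = ⇔.trans (+-monoʳ-≤-⇔ (- y)) (≤-cong (//-rightDividesʳ y x) (+-identityˡ (- y)))

  sumF≡sum : ∀ {k} (f : Fin k → Carrier) → sumF f ≡ sum f
  sumF≡sum {zero}  f = ≡.refl
  sumF≡sum {suc k} f = cong (f zero +_) (sumF≡sum (f ∘ suc))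

  sumF-cong : ∀ {k} {f g : Fin k → Carrier} → (∀ i → f i ≈ g i) → sumF f ≈ sumF g
  sumF-cong {k} {f} {g} f≈g = begin
    sumF f  ≡⟨ sumF≡sum f ⟩
    sum f   ≈⟨ sum-cong-≋ {k} f≈g ⟩
    sum g   ≡⟨ sumF≡sum g ⟨
    sumF g  ∎

  sumF-+ : ∀ {k} (f g : Fin k → Carrier) → sumF (λ i → f i + g i) ≈ sumF f + sumF g
  sumF-+ {k} f g = begin
    sumF (λ i → f i + g i)  ≡⟨ sumF≡sum {k} (λ i → f i + g i) ⟩
    sum (λ i → f i + g i)   ≈⟨ ∑-distrib-+ f g ⟩
    sum f + sum g           ≡⟨ cong₂ _+_ (sumF≡sum f) (sumF≡sum g) ⟨
    sumF f + sumF g         ∎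

  sumF-*ʳ : ∀ {k} (f : Fin k → Carrier) x → sumF f * x ≈ sumF (λ i → f i * x)
  sumF-*ʳ {k} f x = begin
    sumF f * x              ≡⟨ cong (_* x) (sumF≡sum f) ⟩
    sum f * x               ≈⟨ *-distribʳ-sum x f ⟩
    sum (λ i → f i * x)     ≡⟨ sumF≡sum {k} (λ i → f i * x) ⟨
    sumF (λ i → f i * x)    ∎

  sumF-zero : ∀ k → sumF {k} (λ _ → 0#) ≈ 0#
  sumF-zero k = trans (reflexive (sumF≡sum {k} (λ _ → 0#))) (sum-replicate-zero k)

  infix 8 _·_
  _·_ : ∀ {d} → Point d → Point d → Carrier
  a · ρ = sumF (λ k → a k * ρ k)

  ·-zeroˡ : ∀ {d} (ρ : Point d) → (λ _ → 0#) · ρ ≈ 0#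
  ·-zeroˡ {d} ρ = trans (sumF-cong (zeroˡ ∘ ρ)) (sumF-zero d)

  ·-distribʳ-+ : ∀ {d} (a b ρ : Point d) → (λ k → a k + b k) · ρ ≈ a · ρ + b · ρ
  ·-distribʳ-+ a b ρ =
    trans (sumF-cong (λ k → distribʳ (ρ k) (a k) (b k))) (sumF-+ (λ k → a k * ρ k) (λ k → b k * ρ k))

  ·-*ʳ : ∀ {d} (a ρ : Point d) x → (λ k → a k * x) · ρ ≈ (a · ρ) * x
  ·-*ʳ a ρ x = trans (sumF-cong (λ k → xy∙z≈xz∙y (a k) x (ρ k))) (sym (sumF-*ʳ (λ k → a k * ρ k) x))

  unit : ∀ {d} → Fin d → Point d
  unit zero    zero    = 1#
  unit zero    (suc k) = 0#
  unit (suc j) zero    = 0#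
  unit (suc j) (suc k) = unit j k

  unit-· : ∀ {d} (j : Fin d) (ρ : Point d) → unit j · ρ ≈ ρ j
  unit-· zero ρ = begin
    1# * ρ zero + (λ _ → 0#) · (ρ ∘ suc)  ≈⟨ +-cong (*-identityˡ (ρ zero)) (·-zeroˡ (ρ ∘ suc)) ⟩
    ρ zero + 0#                            ≈⟨ +-identityʳ (ρ zero) ⟩
    ρ zero                                 ∎
  unit-· (suc j) ρ = begin
    0# * ρ zero + unit j · (ρ ∘ suc)       ≈⟨ +-cong (zeroˡ (ρ zero)) (unit-· j (ρ ∘ suc)) ⟩
    0# + ρ (suc j)                         ≈⟨ +-identityˡ (ρ (suc j)) ⟩
    ρ (suc j)                              ∎

  Affine : ∀ {d} → (Point d → Carrier) → Set (c ⊔ ℓ)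
  Affine {d} f = Σ (Point d) λ a → Σ Carrier λ b → ∀ ρ → f ρ ≈ a · ρ + b

  module _ {d : ℕ} where

    affine-cong : {f g : Point d → Carrier} → (∀ ρ → f ρ ≈ g ρ) → Affine f → Affine g
    affine-cong f≈g (a , b , f≈) = a , b , λ ρ → trans (sym (f≈g ρ)) (f≈ ρ)

    affine-const : ∀ x → Affine {d} (λ _ → x)
    affine-const x = (λ _ → 0#) , x , λ ρ → begin
      x                    ≈⟨ +-identityˡ x ⟨
      0# + x               ≈⟨ +-congʳ (·-zeroˡ ρ) ⟨
      (λ _ → 0#) · ρ + x   ∎

    affine-coordinate : (j : Fin d) → Affine (λ ρ → ρ j)
    affine-coordinate j = unit j , 0# , λ ρ → begin
      ρ j             ≈⟨ unit-· j ρ ⟨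
      unit j · ρ      ≈⟨ +-identityʳ _ ⟨
      unit j · ρ + 0# ∎

    affine-+ : {f g : Point d → Carrier} → Affine f → Affine g → Affine (λ ρ → f ρ + g ρ)
    affine-+ {f} {g} (a , b , f≈) (a′ , b′ , g≈) = (λ k → a k + a′ k) , b + b′ , λ ρ → begin
      f ρ + g ρ                          ≈⟨ +-cong (f≈ ρ) (g≈ ρ) ⟩
      (a · ρ + b) + (a′ · ρ + b′)        ≈⟨ interchange _ _ _ _ ⟩
      (a · ρ + a′ · ρ) + (b + b′)        ≈⟨ +-congʳ (·-distribʳ-+ a a′ ρ) ⟨
      (λ k → a k + a′ k) · ρ + (b + b′)  ∎

    affine-*ʳ : {f : Point d → Carrier} → Affine f → ∀ x → Affine (λ ρ → f ρ * x)
    affine-*ʳ {f} (a , b , f≈) x = (λ k → a k * x) , b * x , λ ρ → begin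
      f ρ * x                        ≈⟨ *-congʳ (f≈ ρ) ⟩
      (a · ρ + b) * x                ≈⟨ distribʳ x (a · ρ) b ⟩
      (a · ρ) * x + b * x            ≈⟨ +-congʳ (·-*ʳ a ρ x) ⟨
      (λ k → a k * x) · ρ + b * x    ∎

    affine-neg : {f : Point d → Carrier} → Affine f → Affine (λ ρ → - f ρ)
    affine-neg {f} f-affine = affine-cong
      (λ ρ → trans (*-comm (f ρ) (- 1#)) (-1*x≈-x (f ρ)))
      (affine-*ʳ f-affine (- 1#))

    affine-sumF : ∀ {k} {f : Fin k → Point d → Carrier} →
                  (∀ i → Affine (f i)) → Affine (λ ρ → sumF (λ i → f i ρ))
    affine-sumF {zero}  _        = affine-const 0#
    affine-sumF {suc k} f-affine = affine-+ (f-affine zero) (affine-sumF (f-affine ∘ suc))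

  record LinearSystem (d : ℕ) : Set c where
    field
      size   : ℕ
      rows   : Fin size → Point d
      bounds : Fin size → Carrier
  open LinearSystem

  Solution : ∀ {d} → LinearSystem d → Pred (Point d) ℓ
  Solution S ρ = ∀ i → (rows S i · ρ) ≤ bounds S i

  Polyhedral : ∀ {d r} → Pred (Point d) r → Set (c ⊔ ℓ ⊔ r)
  Polyhedral {d} Q = Σ (LinearSystem d) λ S → ∀ ρ → Q ρ ⇔ Solution S ρ

  module _ {d : ℕ} where

    polyhedral-cong : ∀ {r s} {Q : Pred (Point d) r} {R : Pred (Point d) s} →
                      (∀ ρ → Q ρ ⇔ R ρ) → Polyhedral Q → Polyhedral R
    polyhedral-cong Q⇔R (S , Q⇔S) = S , λ ρ → ⇔.trans (⇔.sym (Q⇔R ρ)) (Q⇔S ρ)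

    halfSpace-polyhedral : (a : Point d) (b : Carrier) → Polyhedral (λ ρ → (a · ρ) ≤ b)
    halfSpace-polyhedral a b =
      record { size = 1 ; rows = λ _ → a ; bounds = λ _ → b } ,
      λ ρ → mk⇔ (λ a·ρ≤b _ → a·ρ≤b) (λ sol → sol zero)

    ∩-polyhedral : ∀ {r s} {Q : Pred (Point d) r} {R : Pred (Point d) s} →
                   Polyhedral Q → Polyhedral R → Polyhedral (Q ∩ R)
    ∩-polyhedral {Q = Q} {R} (S , Q⇔S) (T , R⇔T) = S∧T , λ ρ →
      ⇔.trans (mk⇔ (λ (q , r) → Equivalence.to (Q⇔S ρ) q , Equivalence.to (R⇔T ρ) r)
                   (λ (s , t) → Equivalence.from (Q⇔S ρ) s , Equivalence.from (R⇔T ρ) t))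
              (⇔.sym (solution-∧ ρ))
      where
      S∧T : LinearSystem d
      S∧T = record { size   = size S ℕ.+ size T
                   ; rows   = [ rows S , rows T ]′ ∘ splitAt (size S)
                   ; bounds = [ bounds S , bounds T ]′ ∘ splitAt (size S) }

      solution-∧ : ∀ ρ → Solution S∧T ρ ⇔ (Solution S ρ × Solution T ρ)
      solution-∧ ρ = mk⇔ split join
        where
        RowHolds : Fin (size S) ⊎ Fin (size T) → Set ℓ
        RowHolds z = ([ rows S , rows T ]′ z · ρ) ≤ [ bounds S , bounds T ]′ z
        split : Solution S∧T ρ → Solution S ρ × Solution T ρ
        split sol = (λ i → subst RowHolds (splitAt-↑ˡ (size S) i (size T)) (sol (i ↑ˡ size T)))
                  , (λ i → subst RowHolds (splitAt-↑ʳ (size S) (size T) i) (sol (size S ↑ʳ i)))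
        join : Solution S ρ × Solution T ρ → Solution S∧T ρ
        join (solS , solT) i with splitAt (size S) i
        ... | inj₁ j = solS j
        ... | inj₂ j = solT j

    guarded-polyhedral : ∀ {p r} {X : Set p} {R : Pred (Point d) r} →
                         Dec X → Polyhedral R → Polyhedral (λ ρ → X → R ρ)
    guarded-polyhedral (yes x) = polyhedral-cong λ ρ → mk⇔ (λ r _ → r) (λ x→r → x→r x)
    guarded-polyhedral (no ¬x) _ =
      record { size = 0 ; rows = λ () ; bounds = λ () } ,
      λ ρ → mk⇔ (λ _ ()) (λ _ x → ⊥-elim (¬x x))

    ⋂-polyhedral : ∀ {k r} {R : Subset k → Pred (Point d) r} →
                   (∀ s → Polyhedral (R s)) → Polyhedral (λ ρ → ∀ s → R s ρ)
    ⋂-polyhedral {zero} R-poly = polyhedral-cong (λ ρ → mk⇔ (λ { r [] → r }) (λ r → r [])) (R-poly [])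
    ⋂-polyhedral {suc k} R-poly = polyhedral-cong
      (λ ρ → mk⇔ (λ { (r₁ , r₀) (inside ∷ s) → r₁ s ; (r₁ , r₀) (outside ∷ s) → r₀ s })
                 (λ r → (λ s → r (inside ∷ s)) , (λ s → r (outside ∷ s))))
      (∩-polyhedral (⋂-polyhedral (R-poly ∘ (inside ∷_))) (⋂-polyhedral (R-poly ∘ (outside ∷_))))

    affine-≤-polyhedral : {f g : Point d → Carrier} → Affine f → Affine g →
                          Polyhedral (λ ρ → f ρ ≤ g ρ)
    affine-≤-polyhedral {f} {g} f-affine g-affine
      with a , b , f-g≈ ← affine-+ f-affine (affine-neg g-affine)
      = polyhedral-cong (⇔.sym ∘ f≤g⇔halfSpace) (halfSpace-polyhedral a (- b))
      where
      f≤g⇔halfSpace : ∀ ρ → f ρ ≤ g ρ ⇔ (a · ρ) ≤ (- b)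
      f≤g⇔halfSpace ρ = ⇔.trans (≤⇔-≤0 (f ρ) (g ρ))
                        (⇔.trans (≤-cong (f-g≈ ρ) refl) (+≤0⇔≤- (a · ρ) b))

  convexPolytope⇒polyhedral : ∀ {d} {Q : Pred (Point d) (c ⊔ ℓ)} → ConvexPolytope Q → Polyhedral Q
  convexPolytope⇒polyhedral (h , a , b , Q⇔ , _) =
    record { size = h ; rows = a ; bounds = b } , Q⇔

  convexPolytope-∩ : ∀ {d} {Q : Pred (Point d) (c ⊔ ℓ)} {R : Pred (Point d) ℓ} →
                     ConvexPolytope Q → Polyhedral R → ConvexPolytope (Q ∩ R)
  convexPolytope-∩ Q-polytope@(_ , _ , _ , _ , M , Q-bounded) R-poly
    with S , Q∩R⇔S ← ∩-polyhedral (convexPolytope⇒polyhedral Q-polytope) R-poly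
    = size S , rows S , bounds S , Q∩R⇔S , M , λ ρ → Q-bounded ρ ∘ proj₁

  module _ {n : ℕ} where

    _≟_ : (A B : Cluster n) → Dec (A ≡ B)
    _≟_ = ≡-dec Bool._≟_

    ∷ʳ≢[] : ∀ {a} {X : Set a} (xs : List X) x → xs ∷ʳ x ≡ [] → ⊥
    ∷ʳ≢[] []      x ()
    ∷ʳ≢[] (_ ∷ _) x ()

    current-[] : ∀ {C} → Current {n} [] C ⇔ ∃ λ i → C ≡ ⁅ i ⁆
    current-[] = mk⇔ (λ C-current → singleton C-current ≡.refl) λ { (i , ≡.refl) → init i }
      where
      singleton : ∀ {L C} → Current {n} L C → L ≡ [] → ∃ λ i → C ≡ ⁅ i ⁆
      singleton (init i)         _     = i , ≡.refl
      singleton (keep {M} _ _ _) L≡[] = ⊥-elim (∷ʳ≢[] M _ L≡[])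
      singleton (new {M} _ _ _)  L≡[] = ⊥-elim (∷ʳ≢[] M _ L≡[])

    current-∷ʳ : ∀ {M A B C} → Current {n} (M ∷ʳ (A , B)) C ⇔
                 ((Current M C × ¬ C ≡ A × ¬ C ≡ B) ⊎ (Current M A × Current M B × ¬ A ≡ B × C ≡ A ∪ B))
    current-∷ʳ = mk⇔ (λ C-current → inversion C-current ≡.refl) λ
      { (inj₁ (C-current , C≢A , C≢B))                  → keep C-current C≢A C≢B
      ; (inj₂ (A-current , B-current , A≢B , ≡.refl)) → new A-current B-current A≢B }
      where
      inversion : ∀ {L M A B C} → Current {n} L C → L ≡ M ∷ʳ (A , B) →
                  (Current M C × ¬ C ≡ A × ¬ C ≡ B) ⊎ (Current M A × Current M B × ¬ A ≡ B × C ≡ A ∪ B)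
      inversion {M = M} (init i) L≡ = ⊥-elim (∷ʳ≢[] M _ (≡.sym L≡))
      inversion {M = M} (keep {M′} C-current C≢A C≢B) L≡ with ∷ʳ-injective M′ M L≡
      ... | ≡.refl , ≡.refl = inj₁ (C-current , C≢A , C≢B)
      inversion {M = M} (new {M′} A-current B-current A≢B) L≡ with ∷ʳ-injective M′ M L≡
      ... | ≡.refl , ≡.refl = inj₂ (A-current , B-current , A≢B , ≡.refl)

    current? : ∀ M C → Dec (Current {n} M C)
    current? M = decide (reverseView M)
      where
      decide : ∀ {M} → Reverse M → ∀ C → Dec (Current {n} M C)
      decide [] C = Dec.map (⇔.sym current-[]) (any? λ i → C ≟ ⁅ i ⁆)
      decide (_ ∶ r ∶ʳ (A , B)) C = Dec.map (⇔.sym current-∷ʳ)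
        (   decide r C ×-dec ¬? (C ≟ A) ×-dec ¬? (C ≟ B)
        ⊎-dec decide r A ×-dec decide r B ×-dec ¬? (A ≟ B) ×-dec C ≟ (A ∪ B))

  module _ {n l m : ℕ} (Δ : Fin l → MergeFunction n) (δ : Fin m → Metric n) where
    open Family Δ δ

    α-affine : ∀ k → Affine (λ ρ → α ρ k)
    α-affine k with toℕ k <? dim
    ... | yes k<dim = affine-coordinate (fromℕ< k<dim)
    ... | no  _     = affine-+ (affine-const 1#) (affine-neg (affine-sumF affine-coordinate))

    Dρ-affine : ∀ A B → Affine (λ ρ → Dρ ρ A B)
    Dρ-affine A B = affine-sumF λ k → affine-*ʳ (α-affine k) _

    minimizes-polyhedral : ∀ M A B → Polyhedral (λ ρ → Minimizes ρ M A B)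
    minimizes-polyhedral M A B =
      ⋂-polyhedral λ A′ → ⋂-polyhedral λ B′ →
        guarded-polyhedral (current? M A′) (guarded-polyhedral (current? M B′)
          (guarded-polyhedral (¬? (A′ ≟ B′))
            (affine-≤-polyhedral (Dρ-affine A B) (Dρ-affine A′ B′))))

    node-convexPolytope : ∀ {P M Q} → ConvexPolytope P → Node P M Q → ConvexPolytope Q
    node-convexPolytope P-polytope root = P-polytope
    node-convexPolytope P-polytope (child {M} {A = A} {B} parent _ _ _ _ _) =
      convexPolytope-∩ (node-convexPolytope P-polytope parent) (minimizes-polyhedral M A B)

lemma6 : ∀ {c ℓ} (F : OrderedField c ℓ) → let open Clustering F in
    (n l m : ℕ) → .{{NonZero n}} → .{{NonZero l}} → .{{NonZero m}}
    → (Δ : Fin l → MergeFunction n) (δ : Fin m → Metric n) → (∀ j → IsMetric (δ j))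
    → let open Family Δ δ in
    (P : Pred (Point dim) _)
    → Σ (Point dim) P → (∀ ρ → P ρ → InUnitCube ρ) → ConvexPolytope P
    → ∀ (M : List (Merge n)) (Q : Pred (Point dim) _) → Node P M Q → ConvexPolytope Q
lemma6 F n l m Δ δ _ P _ _ P-polytope M Q node = node-convexPolytope F Δ δ P-polytope node
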